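{- For all integers $c,k\ge 1$, every hypergraph $H_k^c$ (constructed as in the context, with any choices of vertex orders) is $k$-uniform and admits no proper $c$-coloring, i.e. for every map $\chi:V(H_k^c)\to\{1,\dots,c\}$ some edge of $H_k^c$ is monochromatic.
   Context: For a linearly ordered set $A=\{a_1<a_2<\dots<a_{tm}\}$, its blocks are $\{a_{im+1},\dots,a_{im+m}\}$, $i=0,\dots,t-1$, and $f_m(A)$ is the family of subsets of $A$ containing exactly one element of each block. Fix $k\ge1$. The vertex-ordered hypergraphs $H_k^c$ are defined recursively in $c$. $H_k^1$: $k$ vertices with an arbitrary linear order and one edge consisting of all $k$ vertices. For $c>1$, take some $H_k^{c-1}$ and let $m$ be its number of vertices. Build a rooted forest whose vertices are partitioned into stages; a stage $S$ of level $j$ is a set of $m^{k-j}$ vertices with a linear order $<_S$. There is one stage of level $0$: $m^k$ vertices in some order, the roots. For each stage $S$ of level $j<k-1$ and each $S'\in f_m(S)$, create a new stage $T(S')$ of level $j+1$ consisting of $m^{k-j-1}$ new vertices, one child of each vertex of $S'$ (joined to it by a forest edge), ordered as their parents are ordered in $<_S$. Stages of level $k-1$ have no children. The vertex set of $H_k^c$ is the set of all forest vertices. Edges: (path edges) for each vertex $v$ in a stage of level $k-1$, the vertex set of the forest path from $v$ to the root of its tree; (transversal edges) for each stage $S$ of level $j$, partition $S$ into its $m^{k-j-1}$ blocks of $m$ consecutive vertices in $<_S$, and on each block place the edges of a copy of $H_k^{c-1}$ via the order-preserving bijection from the vertices of $H_k^{c-1}$ to the block. Finally $H_k^c$ is given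 an arbitrary linear order of its vertices. -}

module Defs where

open import Level using (0ℓ)
open import Data.Nat using (ℕ; zero; suc)
open import Data.Fin using (Fin)
open import Data.Fin.Subset using (Subset; _∈_; ⊤; ∣_∣)
open import Data.Vec using (Vec; _∷_)
open import Data.List using (List; []; _∷_; map)
import Data.List.Membership.Propositional as LM
open import Data.Product using (Σ; Σ-syntax; ∃; ∃-syntax; _×_)
open import Data.Sum using (_⊎_)
open import Function.Bundles using (_⇔_; _↔_; Inverse)
open import Relation.Binary.PropositionalEquality using (_≡_)

-- Vertex-ordered hypergraphs.
-- A vertex-ordered hypergraph with n vertices has vertex set Fin n,
-- ordered by the usual order of Fin n; its edges are given by a
-- predicate on subsets of Fin n.

record Hypergraph : Set₁ where
  field
    n    : ℕ
    Edge : Subset n → Set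
open Hypergraph public

Uniform : ℕ → Hypergraph → Set
Uniform k H = ∀ e → Edge H e → ∣ e ∣ ≡ k

HasMonochromaticEdge : ∀ {c} (H : Hypergraph) → (Fin (n H) → Fin c) → Set
HasMonochromaticEdge H χ =
  Σ[ e ∈ Subset (n H) ] (Edge H e × (∀ x y → x ∈ e → y ∈ e → χ x ≡ χ y))

-- The rooted forest of the construction, for a fixed m = |V(H_k^{c-1})|.
--
-- A stage with "remaining size" q has m^q vertices; its positions are
-- digit vectors  p : Vec (Fin m) q,  ordered little-endian (the LAST
-- digits are most significant, the head digit least significant).
-- Hence a position  d ∷ b  lies in the block indexed by  b  (blocks of
-- m consecutive positions), and  d  is its place within the block.
-- An element S' ∈ f_m(S) of a stage S with remaining size suc (suc r)
-- is the same as a map  g : Vec (Fin m) (suc r) → Fin m  choosing the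
-- element  g b ∷ b  of block b.  The new stage T(S') has positions
-- Vec (Fin m) (suc r): the child at position b has parent  g b ∷ b,
-- and the children are ordered as their parents (i.e. by b).
--
-- Vtx m r : the vertices of the part of the forest consisting of a
-- stage of remaining size r and all stages descending from it.
--   top p   : the vertex at position p of that top stage
--   sub g w : the vertex w inside the sub-forest rooted at T(g)
-- (stages of remaining size 1, i.e. level k-1, have no children).

data Vtx (m : ℕ) : ℕ → Set where
  top : ∀ {r} → Vec (Fin m) (suc r) → Vtx m (suc r)
  sub : ∀ {r} → (Vec (Fin m) (suc r) → Fin m) → Vtx m (suc r) →
        Vtx m (suc (suc r))

-- stages of the forest with top stage of remaining size r;
-- Stage m r q : stages of remaining size q
data Stage (m : ℕ) : ℕ → ℕ → Set where
  here : ∀ {r} → Stage m (suc r) (suc r)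
  into : ∀ {r q} → (Vec (Fin m) (suc r) → Fin m) → Stage m (suc r) q →
         Stage m (suc (suc r)) q

vtxAt : ∀ {m r q} → Stage m r q → Vec (Fin m) q → Vtx m r
vtxAt here       p = top p
vtxAt (into g s) p = sub g (vtxAt s p)

data IsLeaf {m : ℕ} : ∀ {r} → Vtx m r → Set where
  leaf-top : (p : Vec (Fin m) 1) → IsLeaf (top p)
  leaf-sub : ∀ {r} {g : Vec (Fin m) (suc r) → Fin m} {w : Vtx m (suc r)} →
             IsLeaf w → IsLeaf (sub g w)

rootPos : ∀ {m r} → Vtx m r → Vec (Fin m) r
rootPos (top p)   = p
rootPos (sub g w) = g (rootPos w) ∷ rootPos w

path : ∀ {m r} → Vtx m r → List (Vtx m r)
path (top p)   = top p ∷ []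
path (sub g w) = top (rootPos (sub g w)) ∷ map (sub g) (path w)

-- the edges of H_k^c, as predicates P on forest vertices (P u means
-- "u belongs to the edge"), given the edge predicate E' of H_k^{c-1}
-- on its m vertices
ForestEdge : (m k : ℕ) → (Subset m → Set) → (Vtx m k → Set) → Set
ForestEdge m k E' P =
  (Σ[ v ∈ Vtx m k ] (IsLeaf v × (∀ u → P u ⇔ LM._∈_ u (path v))))
  ⊎
  -- transversal edges: stage s, block b, copy of edge e' of H_k^{c-1}
  -- via the order-preserving bijection  d ↦ d ∷ b
  (Σ[ q ∈ ℕ ] Σ[ s ∈ Stage m k (suc q) ] Σ[ b ∈ Vec (Fin m) q ]
     Σ[ e' ∈ Subset m ]
       (E' e' × (∀ u → P u ⇔ (Σ[ d ∈ Fin m ] (d ∈ e' × u ≡ vtxAt s (d ∷ b))))))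

-- IsH k c H : H is (isomorphic, as a hypergraph, to) some H_k^c built
-- as in the paper with some choice of vertex orders.  The final
-- arbitrary linear order of H_k^c is the bijection σ between Fin (n H)
-- and the forest vertices.

data IsH (k : ℕ) : ℕ → Hypergraph → Set₁ where
  base : (H : Hypergraph) → n H ≡ k →
         (∀ e → Edge H e ⇔ (e ≡ ⊤)) → IsH k 1 H
  step : ∀ {c} (H' H : Hypergraph) → IsH k c H' →
         (σ : Fin (n H) ↔ Vtx (n H') k) →
         (∀ e → Edge H e ⇔
                ForestEdge (n H') k (Edge H') (λ u → Inverse.from σ u ∈ e)) →
         IsH k (suc c) H

-- Non-colourability is proved by induction on c, reserving colour 0 for the
-- forest.  Look at the blocks of the root stage: if one of them avoids
-- colour 0, it is coloured with c colours, so the copy of H_k^{c-1} on it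
-- has a monochromatic edge.  Otherwise choose a vertex of colour 0 in every
-- block; this is an element S' of f_m(S), and the argument repeats in the
-- stage T(S').  If it never stops at a block, the chosen vertices after k
-- stages form a root-to-leaf path of colour 0, i.e. a monochromatic path
-- edge.  Uniformity holds because paths have k vertices and transversal
-- edges are copies of k-edges of H_k^{c-1}.
module Submission where

open import Defs
open import Data.Nat using (ℕ; zero; suc; _≤_; s≤s)
open import Data.Fin using (Fin; punchOut)
import Data.Fin as Fin
open import Data.Fin.Properties using (any?; _≟_; ∀-cons; punchOut-injective; suc-injective)
open import Data.Fin.Subset using (Subset; ∣_∣; ⊤; ⁅_⁆; ⋃; inside; outside)
  renaming (_∈_ to _∈ₛ_)
open import Data.Fin.Subset.Properties using (∣⊤∣≡n; ∉⊥; x∈⁅x⁆; x∈⁅y⁆⇒x≡y; x∈p∪q⁺; x∈p∪q⁻)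
open import Data.Vec using (Vec; []; _∷_; here; there)
open import Data.Vec.Properties using (∷-injectiveˡ)
open import Data.List using (List; []; _∷_; length; map)
open import Data.List.Properties using (length-map)
open import Data.List.Relation.Unary.Any using (here; there)
open import Data.List.Relation.Unary.AllPairs using ([]; _∷_)
import Data.List.Relation.Unary.All as All
import Data.List.Relation.Unary.All.Properties as All
open import Data.List.Relation.Unary.Unique.Propositional using (Unique)
import Data.List.Relation.Unary.Unique.Propositional.Properties as Unique
open import Data.List.Membership.Propositional using (_∈_)
open import Data.List.Membership.Propositional.Properties using (∈-map⁺; ∈-map⁻)
open import Data.List.Membership.Propositional.Properties.WithK using (unique∧set⇒bag)
open import Data.List.Relation.Binary.BagAndSetEquality using (∼bag⇒↭)
open import Data.List.Relation.Binary.Permutation.Propositional.Properties using (↭-length)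
open import Data.Product using (Σ-syntax; ∃; _×_; _,_; proj₁; proj₂)
open import Data.Sum using (_⊎_; inj₁; inj₂)
import Data.Sum as Sum
open import Data.Empty using (⊥-elim)
open import Function using (_∘_)
open import Function.Definitions using (Injective)
open import Function.Bundles using (_⇔_; mk⇔; Equivalence; _↔_; Inverse)
import Function.Properties.Equivalence as ⇔
open import Relation.Nullary using (yes; no)
open import Relation.Binary.PropositionalEquality

open Equivalence using (to; from)

ConstantOn : ∀ {A B : Set} → (A → B) → (A → Set) → Set
ConstantOn f P = ∀ x y → P x → P y → f x ≡ f y

∀⊎∃-Fin : ∀ n {A B : Fin n → Set} → (∀ i → A i ⊎ B i) → (∀ i → A i) ⊎ ∃ B
∀⊎∃-Fin zero    A⊎B = inj₁ λ ()
∀⊎∃-Fin (suc n) A⊎B with A⊎B Fin.zero | ∀⊎∃-Fin n (A⊎B ∘ Fin.suc)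
... | inj₂ b | _            = inj₂ (Fin.zero , b)
... | inj₁ _ | inj₂ (i , b) = inj₂ (Fin.suc i , b)
... | inj₁ a | inj₁ as      = inj₁ (∀-cons a as)

∀⊎∃-Vec : ∀ {m} n {A B : Vec (Fin m) n → Set} →
          (∀ v → A v ⊎ B v) → (∀ v → A v) ⊎ ∃ B
∀⊎∃-Vec zero    A⊎B = Sum.map (λ { a [] → a }) ([] ,_) (A⊎B [])
∀⊎∃-Vec {m} (suc n) A⊎B =
  Sum.map (λ { as (i ∷ v) → as i v }) (λ { (i , v , b) → i ∷ v , b })
          (∀⊎∃-Fin m (λ i → ∀⊎∃-Vec n (A⊎B ∘ (i ∷_))))

HasSize : ∀ {A : Set} → ℕ → (A → Set) → Set
HasSize {A} k P = Σ[ xs ∈ List A ] (Unique xs × length xs ≡ k × (∀ x → P x ⇔ x ∈ xs))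

module _ {A : Set} {k : ℕ} where

  HasSize-resp : {P Q : A → Set} → (∀ x → P x ⇔ Q x) → HasSize k P → HasSize k Q
  HasSize-resp P⇔Q (xs , xs! , len , P⇔) = xs , xs! , len , λ x → ⇔.trans (⇔.sym (P⇔Q x)) (P⇔ x)

  HasSize-length : {P : A → Set} {xs : List A} → Unique xs → (∀ x → P x ⇔ x ∈ xs) →
                   HasSize k P → length xs ≡ k
  HasSize-length xs! P⇔xs (ys , ys! , len , P⇔ys) =
    trans (↭-length (∼bag⇒↭ (unique∧set⇒bag xs! ys! λ {x} → ⇔.trans (⇔.sym (P⇔xs x)) (P⇔ys x))))
          len

  HasSize-image : ∀ {B : Set} {f : A → B} {P : A → Set} → Injective _≡_ _≡_ f →
                  HasSize k P → HasSize k (λ y → Σ[ x ∈ A ] (P x × y ≡ f x))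
  HasSize-image {f = f} {P} f-inj (xs , xs! , len , P⇔) =
    map f xs , Unique.map⁺ f-inj xs! , trans (length-map f xs) len , λ y → mk⇔ image⇒ image⇐
    where
    image⇒ : ∀ {y} → Σ[ x ∈ A ] (P x × y ≡ f x) → y ∈ map f xs
    image⇒ (x , Px , refl) = ∈-map⁺ f (to (P⇔ x) Px)
    image⇐ : ∀ {y} → y ∈ map f xs → Σ[ x ∈ A ] (P x × y ≡ f x)
    image⇐ y∈ with ∈-map⁻ f y∈
    ... | x , x∈ , eq = x , from (P⇔ x) x∈ , eq

toList : ∀ {n} → Subset n → List (Fin n)
toList []            = []
toList (inside ∷ p)  = Fin.zero ∷ map Fin.suc (toList p)
toList (outside ∷ p) = map Fin.suc (toList p)

toList-HasSize : ∀ {n} (p : Subset n) → HasSize ∣ p ∣ (_∈ₛ p)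
toList-HasSize [] = [] , [] , refl , λ ()
toList-HasSize (inside ∷ p) with toList-HasSize p
... | xs , xs! , len , p⇔ =
  Fin.zero ∷ map Fin.suc xs ,
  All.map⁺ (All.universal (λ _ ()) xs) ∷ Unique.map⁺ suc-injective xs! ,
  cong suc (trans (length-map Fin.suc xs) len) ,
  λ { Fin.zero    → mk⇔ (λ _ → here refl) (λ _ → here)
    ; (Fin.suc x) → mk⇔ (λ { (there x∈) → there (∈-map⁺ Fin.suc (to (p⇔ x) x∈)) })
                        (λ { (there x∈) → there (from (p⇔ x) (suc∈map x∈)) }) }
  where
  suc∈map : ∀ {x} → Fin.suc x ∈ map Fin.suc xs → x ∈ xs
  suc∈map x∈ with ∈-map⁻ Fin.suc x∈
  ... | _ , x∈xs , refl = x∈xs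
toList-HasSize (outside ∷ p) =
  HasSize-resp shift (HasSize-image suc-injective (toList-HasSize p))
  where
  shift : ∀ x → (Σ[ y ∈ Fin _ ] (y ∈ₛ p × x ≡ Fin.suc y)) ⇔ x ∈ₛ (outside ∷ p)
  shift x = mk⇔ (λ { (y , y∈ , refl) → there y∈ }) (λ { (there {i = y} y∈) → y , y∈ , refl })

HasSize⇒∣∣≡ : ∀ {n k} {p : Subset n} → HasSize k (_∈ₛ p) → ∣ p ∣ ≡ k
HasSize⇒∣∣≡ {p = p} size with toList-HasSize p
... | xs , xs! , len , p⇔ = trans (sym len) (HasSize-length xs! p⇔ size)

fromList : ∀ {n} → List (Fin n) → Subset n
fromList xs = ⋃ (map ⁅_⁆ xs)

∈-fromList : ∀ {n} {x : Fin n} (xs : List (Fin n)) → x ∈ₛ fromList xs ⇔ x ∈ xs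
∈-fromList xs = mk⇔ (⇒ xs) (⇐ xs)
  where
  ⇒ : ∀ {x} xs → x ∈ₛ fromList xs → x ∈ xs
  ⇒ []       x∈ = ⊥-elim (∉⊥ x∈)
  ⇒ (y ∷ ys) x∈ with x∈p∪q⁻ ⁅ y ⁆ (fromList ys) x∈
  ... | inj₁ x∈y  = here (x∈⁅y⁆⇒x≡y y x∈y)
  ... | inj₂ x∈ys = there (⇒ ys x∈ys)
  ⇐ : ∀ {x} xs → x ∈ xs → x ∈ₛ fromList xs
  ⇐ (y ∷ ys) (here refl) = x∈p∪q⁺ (inj₁ (x∈⁅x⁆ y))
  ⇐ (y ∷ ys) (there x∈)  = x∈p∪q⁺ (inj₂ (⇐ ys x∈))

module _ {m : ℕ} where

  sub-injective : ∀ {r} {g : Vec (Fin m) (suc r) → Fin m} → Injective _≡_ _≡_ (sub g)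
  sub-injective refl = refl

  vtxAt-injective : ∀ {r q} (s : Stage m r q) → Injective _≡_ _≡_ (vtxAt s)
  vtxAt-injective here       refl = refl
  vtxAt-injective (into g s) eq   = vtxAt-injective s (sub-injective eq)

  path-unique : ∀ {r} (v : Vtx m r) → Unique (path v)
  path-unique (top p)   = All.[] ∷ []
  path-unique (sub g w) =
    All.map⁺ (All.universal (λ _ ()) (path w)) ∷ Unique.map⁺ sub-injective (path-unique w)

  length-path : ∀ {r} {v : Vtx m r} → IsLeaf v → length (path v) ≡ r
  length-path (leaf-top p) = refl
  length-path (leaf-sub {g = g} {w} leaf) =
    cong suc (trans (length-map (sub g) (path w)) (length-path leaf))

  ForestEdge-resp : ∀ {r} {E' : Subset m → Set} {P Q : Vtx m r → Set} →
                    (∀ u → P u ⇔ Q u) → ForestEdge m r E' P → ForestEdge m r E' Q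
  ForestEdge-resp P⇔Q (inj₁ (v , leaf , P⇔)) =
    inj₁ (v , leaf , λ u → ⇔.trans (⇔.sym (P⇔Q u)) (P⇔ u))
  ForestEdge-resp P⇔Q (inj₂ (q , s , b , e' , E , P⇔)) =
    inj₂ (q , s , b , e' , E , λ u → ⇔.trans (⇔.sym (P⇔Q u)) (P⇔ u))

  ForestEdge-HasSize : ∀ {r} {E' : Subset m → Set} {P : Vtx m r → Set} →
                       (∀ e' → E' e' → ∣ e' ∣ ≡ r) → ForestEdge m r E' P → HasSize r P
  ForestEdge-HasSize _ (inj₁ (v , leaf , P⇔)) = path v , path-unique v , length-path leaf , P⇔
  ForestEdge-HasSize E'-uniform (inj₂ (q , s , b , e' , E , P⇔)) =
    HasSize-resp (λ u → ⇔.sym (P⇔ u))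
      (HasSize-image (∷-injectiveˡ ∘ vtxAt-injective s)
        (subst (λ k → HasSize k (_∈ₛ e')) (E'-uniform e' E) (toList-HasSize e')))

module _ {m c : ℕ} (E' : Subset m → Set)
         (E'-monochromatic : (χ : Fin m → Fin c) →
                             Σ[ e' ∈ Subset m ] (E' e' × ConstantOn χ (_∈ₛ e'))) where

  zero-avoiding-monochromatic : (χ : Fin m → Fin (suc c)) → (∀ d → Fin.zero ≢ χ d) →
                                Σ[ e' ∈ Subset m ] (E' e' × ConstantOn χ (_∈ₛ e'))
  zero-avoiding-monochromatic χ nonzero with E'-monochromatic (λ d → punchOut (nonzero d))
  ... | e' , E , constant =
    e' , E , λ x y x∈ y∈ → punchOut-injective (nonzero x) (nonzero y) (constant x y x∈ y∈)

  zero⊎monochromatic : (χ : Fin m → Fin (suc c)) →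
                       (∃ λ d → χ d ≡ Fin.zero) ⊎ Σ[ e' ∈ Subset m ] (E' e' × ConstantOn χ (_∈ₛ e'))
  zero⊎monochromatic χ with any? (λ d → χ d ≟ Fin.zero)
  ... | yes hit  = inj₁ hit
  ... | no miss = inj₂ (zero-avoiding-monochromatic χ λ d eq → miss (d , sym eq))

  ZeroPath : ∀ {r} → (Vtx m r → Fin (suc c)) → Set
  ZeroPath χ = Σ[ w ∈ Vtx m _ ] (IsLeaf w × (∀ u → u ∈ path w → χ u ≡ Fin.zero))

  MonochromaticCopy : ∀ {r} → (Vtx m r → Fin (suc c)) → Set
  MonochromaticCopy {r} χ =
    Σ[ q ∈ ℕ ] Σ[ s ∈ Stage m r (suc q) ] Σ[ b ∈ Vec (Fin m) q ] Σ[ e' ∈ Subset m ]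
      (E' e' × ConstantOn (λ d → χ (vtxAt s (d ∷ b))) (_∈ₛ e'))

  module _ {r} {χ : Vtx m (suc (suc r)) → Fin (suc c)} (g : Vec (Fin m) (suc r) → Fin m) where

    ZeroPath-sub : (∀ b → χ (top (g b ∷ b)) ≡ Fin.zero) → ZeroPath (χ ∘ sub g) → ZeroPath χ
    ZeroPath-sub roots-zero (w , leaf , path-zero) = sub g w , leaf-sub leaf , path-zero′
      where
      path-zero′ : ∀ u → u ∈ path (sub g w) → χ u ≡ Fin.zero
      path-zero′ _ (here refl) = roots-zero (rootPos w)
      path-zero′ _ (there u∈) with ∈-map⁻ (sub g) u∈
      ... | u , u∈path , refl = path-zero u u∈path

    MonochromaticCopy-sub : MonochromaticCopy (χ ∘ sub g) → MonochromaticCopy χ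
    MonochromaticCopy-sub (q , s , b , e' , E , constant) = q , into g s , b , e' , E , constant

  zeroPath⊎monochromaticCopy : ∀ r (χ : Vtx m (suc r) → Fin (suc c)) →
                               ZeroPath χ ⊎ MonochromaticCopy χ
  descend : ∀ r (χ : Vtx m (suc r) → Fin (suc c)) (g : Vec (Fin m) r → Fin m) →
            (∀ b → χ (top (g b ∷ b)) ≡ Fin.zero) → ZeroPath χ ⊎ MonochromaticCopy χ

  zeroPath⊎monochromaticCopy r χ
    with ∀⊎∃-Vec r (λ b → zero⊎monochromatic (λ d → χ (top (d ∷ b))))
  ... | inj₂ (b , e' , E , constant) = inj₂ (r , here , b , e' , E , constant)
  ... | inj₁ zeros                   = descend r χ (proj₁ ∘ zeros) (proj₂ ∘ zeros)

  descend zero    χ g roots-zero =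
    inj₁ (top (g [] ∷ []) , leaf-top _ , λ { _ (here refl) → roots-zero [] })
  descend (suc r) χ g roots-zero =
    Sum.map (ZeroPath-sub g roots-zero) (MonochromaticCopy-sub {χ = χ} g)
            (zeroPath⊎monochromaticCopy r (χ ∘ sub g))

  ForestEdge-monochromatic : ∀ r (χ : Vtx m (suc r) → Fin (suc c)) →
    Σ[ P ∈ (Vtx m (suc r) → Set) ] (ForestEdge m (suc r) E' P × ConstantOn χ P)
  ForestEdge-monochromatic r χ with zeroPath⊎monochromaticCopy r χ
  ... | inj₁ (w , leaf , path-zero) =
    (_∈ path w) , inj₁ (w , leaf , λ _ → ⇔.refl) ,
    λ u v u∈ v∈ → trans (path-zero u u∈) (sym (path-zero v v∈))
  ... | inj₂ (q , s , b , e' , E , constant) =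
    _ , inj₂ (q , s , b , e' , E , λ _ → ⇔.refl) ,
    λ { _ _ (d , d∈ , refl) (d' , d'∈ , refl) → constant d d' d∈ d'∈ }

module Pullback {V : Set} {k : ℕ} (H : Hypergraph) (σ : Fin (n H) ↔ V)
  (F : (V → Set) → Set)
  (F-resp : ∀ {P Q} → (∀ u → P u ⇔ Q u) → F P → F Q)
  (F-HasSize : ∀ {P} → F P → HasSize k P)
  (Edge⇔F : ∀ e → Edge H e ⇔ F (λ u → Inverse.from σ u ∈ₛ e)) where

  open Inverse σ using ()
    renaming (to to σ⁺; from to σ⁻; strictlyInverseˡ to σ⁺σ⁻; strictlyInverseʳ to σ⁻σ⁺)

  σ⁻-injective : Injective _≡_ _≡_ σ⁻
  σ⁻-injective {u} {v} eq = trans (sym (σ⁺σ⁻ u)) (trans (cong σ⁺ eq) (σ⁺σ⁻ v))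

  uniform : Uniform k H
  uniform e E =
    HasSize⇒∣∣≡ (HasSize-resp image⇔ (HasSize-image σ⁻-injective (F-HasSize (to (Edge⇔F e) E))))
    where
    image⇔ : ∀ x → (Σ[ u ∈ V ] (σ⁻ u ∈ₛ e × x ≡ σ⁻ u)) ⇔ x ∈ₛ e
    image⇔ x = mk⇔ (λ { (u , u∈ , refl) → u∈ })
                   (λ x∈ → σ⁺ x , subst (_∈ₛ e) (sym (σ⁻σ⁺ x)) x∈ , sym (σ⁻σ⁺ x))

  monochromatic : ∀ {c} (χ : Fin (n H) → Fin c) →
                  Σ[ P ∈ (V → Set) ] (F P × ConstantOn (χ ∘ σ⁻) P) → HasMonochromaticEdge H χ
  monochromatic χ (P , FP , constant) = e , from (Edge⇔F e) (F-resp P⇔ FP) , constant′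
    where
    us : List V
    us = proj₁ (F-HasSize FP)
    P⇔us : ∀ u → P u ⇔ u ∈ us
    P⇔us = proj₂ (proj₂ (proj₂ (F-HasSize FP)))
    e : Subset (n H)
    e = fromList (map σ⁻ us)
    P⇔ : ∀ u → P u ⇔ σ⁻ u ∈ₛ e
    P⇔ u = mk⇔ (λ Pu → from (∈-fromList (map σ⁻ us)) (∈-map⁺ σ⁻ (to (P⇔us u) Pu))) P⇐
      where
      P⇐ : σ⁻ u ∈ₛ e → P u
      P⇐ u∈ with ∈-map⁻ σ⁻ (to (∈-fromList (map σ⁻ us)) u∈)
      ... | v , v∈ , eq = from (P⇔us u) (subst (_∈ us) (sym (σ⁻-injective eq)) v∈)
    constant′ : ConstantOn χ (_∈ₛ e)
    constant′ x y x∈ y∈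
      with ∈-map⁻ σ⁻ (to (∈-fromList (map σ⁻ us)) x∈) | ∈-map⁻ σ⁻ (to (∈-fromList (map σ⁻ us)) y∈)
    ... | u , u∈ , refl | v , v∈ , refl = constant u v (from (P⇔us u) u∈) (from (P⇔us v) v∈)

IsH⇒uniform : ∀ {k c H} → IsH k c H → Uniform k H
IsH⇒uniform (base H n≡k Edge⇔⊤) e E = trans (cong ∣_∣ (to (Edge⇔⊤ e) E)) (trans (∣⊤∣≡n _) n≡k)
IsH⇒uniform (step H' H IsH' σ Edge⇔) =
  Pullback.uniform H σ _ ForestEdge-resp (ForestEdge-HasSize (IsH⇒uniform IsH')) Edge⇔

IsH⇒monochromatic : ∀ {k c H} → IsH (suc k) c H → (χ : Fin (n H) → Fin c) → HasMonochromaticEdge H χ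
IsH⇒monochromatic (base H _ Edge⇔⊤) χ =
  ⊤ , from (Edge⇔⊤ ⊤) refl , λ x y _ _ → Fin1-trivial (χ x) (χ y)
  where
  Fin1-trivial : (i j : Fin 1) → i ≡ j
  Fin1-trivial Fin.zero Fin.zero = refl
IsH⇒monochromatic {k} (step H' H IsH' σ Edge⇔) χ =
  Pullback.monochromatic H σ _ ForestEdge-resp (ForestEdge-HasSize (IsH⇒uniform IsH')) Edge⇔ χ
    (ForestEdge-monochromatic (Edge H') (IsH⇒monochromatic IsH') k (χ ∘ Inverse.from σ))

lemma1 : (k c : ℕ) → 1 ≤ k → 1 ≤ c → (H : Hypergraph) → IsH k c H →
    Uniform k H × ((χ : Fin (n H) → Fin c) → HasMonochromaticEdge H χ)
lemma1 (suc k) c (s≤s _) _ H IsH-H = IsH⇒uniform IsH-H , IsH⇒monochromatic IsH-H
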